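{- Let $n$ and $m$ be positive integers with $m\geq n+1$. For every integer $r$ with $0\leq r\leq m-1$, the number of pointed $(n,m)$-lattice paths with pointed rightmost minimum length $r$ equals the number of pointed $(n,m)$-lattice paths with pointed rightmost minimum length $0$, and this number is $\frac{1}{m}\binom{2n}{n}\binom{m}{n+1}$, independent of $r$.
   Context: An $(n,m)$-lattice path is a sequence $P=(x_1,y_1)(x_2,y_2)\cdots(x_{n+1},y_{n+1})$ of vectors in $\mathbb{Z}^2$ such that $1-n\leq y_i\leq 1$ for all $i$, $\sum_{i=1}^{n+1}y_i=1$, $1\leq x_i\leq m-1$ for all $i$, and $\sum_{i=1}^{n+1}x_i=m$. For such $P$ put $a_0=b_0=0$, $a_i=\sum_{j=1}^{i}y_j$, $b_i=\sum_{j=1}^{i}x_j$ for $1\leq i\leq n+1$. A minimum point of $P$ is a point $(b_i,a_i)$ with $a_i\leq a_j$ for all $j\in\{0,\ldots,n+1\}$; the rightmost minimum point is the minimum point with the largest $b_i$, and if it is $(b_i,a_i)$ then $RML(P)=b_i$. A pointed $(n,m)$-lattice path is a pair $\dot{P}=[P;j]$ with $P$ an $(n,m)$-lattice path and $0\leq j\leq x_{n+1}-1$; its pointed rightmost minimum length is $PRML(\dot{P})=RML(P)+j$. -}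

module Defs where

open import Data.Nat using (ℕ; zero; suc)
open import Data.Integer using (ℤ; +_; _+_; _-_; _≤_; _<_; _≤?_)
open import Data.Product using (Σ; _×_; _,_)
open import Data.List using (List; []; _∷_)
open import Data.Vec using (Vec; []; _∷_; last)
open import Data.Vec.Relation.Unary.All using (All)
open import Relation.Nullary using (yes; no)
open import Relation.Binary.PropositionalEquality using (_≡_)

Step : Set
Step = ℤ × ℤ

ValidStep : ℕ → ℕ → Step → Set
ValidStep n m (x , y) = (+ 1 ≤ x) × (x ≤ + m - + 1) × (+ 1 - + n ≤ y) × (y ≤ + 1)

sumX : ∀ {k} → Vec Step k → ℤ
sumX [] = + 0
sumX ((x , _) ∷ v) = x + sumX v

sumY : ∀ {k} → Vec Step k → ℤ
sumY [] = + 0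
sumY ((_ , y) ∷ v) = y + sumY v

LatticePath : ℕ → ℕ → Set
LatticePath n m =
  Σ (Vec Step (suc n)) λ v → All (ValidStep n m) v × (sumX v ≡ + m) × (sumY v ≡ + 1)

pointsFrom : ∀ {k} → ℤ → ℤ → Vec Step k → List (ℤ × ℤ)
pointsFrom b a [] = []
pointsFrom b a ((x , y) ∷ v) = (b + x , a + y) ∷ pointsFrom (b + x) (a + y) v

-- Rightmost minimum: scanning points left to right, keep the current candidate
-- (b , a) and replace it by any later point with a' ≤ a.  Returns its b-coordinate.
rmlScan : ℤ → ℤ → List (ℤ × ℤ) → ℤ
rmlScan b a [] = b
rmlScan b a ((b' , a') ∷ ps) with a' ≤? a
... | yes _ = rmlScan b' a' ps
... | no  _ = rmlScan b a ps

RML : ∀ {n m} → LatticePath n m → ℤ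
RML (v , _) = rmlScan (+ 0) (+ 0) (pointsFrom (+ 0) (+ 0) v)

lastX : ∀ {n m} → LatticePath n m → ℤ
lastX (v , _) with last v
... | (x , _) = x

PointedPath : ℕ → ℕ → Set
PointedPath n m = Σ (LatticePath n m) λ P → Σ ℕ λ j → + j < lastX P

PRML : ∀ {n m} → PointedPath n m → ℤ
PRML (P , j , _) = RML P + + j

PointedWithPRML : ℕ → ℕ → ℕ → Set
PointedWithPRML n m r = Σ (PointedPath n m) λ p → PRML p ≡ + r

-- Cycle lemma for pointed paths.  Cutting a path at its rightmost minimum and swapping the two pieces
-- gives a positive path: all of its points after the origin lie strictly above the origin.  Conversely,
-- a positive path Q and a value r < m determine exactly one pointed path with PRML r: cut Q after the
-- step covering horizontal position m - r, swap the pieces so that this step comes last, and point at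
-- the distance from position m - r to the end of that step.  So every fibre PRML = r (0 ≤ r < m) is in
-- bijection with the positive paths, the m fibres partition the pointed paths, and m times the fibre
-- size is the number of pointed paths.  Writing a step as (1 + a , 1 - z), a pointed path is a weak
-- composition of n into n + 1 parts (the z's) together with a weak composition of m - n - 1 into n + 1
-- parts carrying a mark in its last part (the a's and the pointer), counted by C(2n, n) and C(m, n + 1).

module Submission where

open import Defs
open import Axiom.UniquenessOfIdentityProofs.WithK using (uip)
open import Data.Empty using (⊥-elim)
open import Data.Fin as Fin using (Fin; toℕ; fromℕ<)
import Data.Fin.Properties as FinP
open import Data.Nat as ℕ using (ℕ; zero; suc; z≤n; s≤s; _∸_)
import Data.Nat.Properties as ℕP
open import Data.Nat.Combinatorics using (_C_)
open import Data.Product using (Σ; _×_; _,_; proj₁; proj₂)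
open import Data.Product.Function.Dependent.Propositional using (Σ-↔)
open import Data.Product.Function.NonDependent.Propositional using (_×-↔_)
open import Data.Sum using (_⊎_; inj₁; inj₂)
open import Data.Sum.Function.Propositional using (_⊎-↔_)
open import Data.Vec as Vec using (Vec; []; _∷_; last; replicate)
open import Function.Bundles using (_↔_; mk↔ₛ′; Inverse; Injection)
open import Function.Properties.Inverse using (↔-refl; ↔-sym; ↔-trans; ↔⇒↣)
open import Function.Related.Propositional using (module EquationalReasoning; bijection)
open import Relation.Nullary as Nullary using (¬_; Dec; yes; no)
open import Relation.Unary using (Irrelevant)
open import Relation.Binary.PropositionalEquality

Fin-↔⇒≡ : ∀ {a b} → Fin a ↔ Fin b → a ≡ b
Fin-↔⇒≡ e =
  FinP.cantor-schröder-bernstein (Injection.injective (↔⇒↣ e)) (Injection.injective (↔⇒↣ (↔-sym e)))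

Σ-≡-irrelevant : ∀ {A : Set} {P : A → Set} → Irrelevant P → {p q : Σ A P} → proj₁ p ≡ proj₁ q → p ≡ q
Σ-≡-irrelevant P-irr {a , p} {.a , p′} refl = cong (a ,_) (P-irr p p′)

restrict-↔ : ∀ {A B : Set} {P : A → Set} {Q : B → Set} (f : A → B) (g : B → A) →
             Irrelevant P → Irrelevant Q →
             (∀ {a} → P a → Q (f a)) → (∀ {b} → Q b → P (g b)) →
             (∀ {a} → P a → g (f a) ≡ a) → (∀ {b} → Q b → f (g b) ≡ b) →
             Σ A P ↔ Σ B Q
restrict-↔ f g P-irr Q-irr f-pres g-pres gf fg =
  mk↔ₛ′ (λ (a , p) → f a , f-pres p) (λ (b , q) → g b , g-pres q)
        (λ (b , q) → Σ-≡-irrelevant Q-irr (fg q))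
        (λ (a , p) → Σ-≡-irrelevant P-irr (gf p))

decidable-subset-of-Fin : ∀ N {P : Fin N → Set} → (∀ i → Dec (P i)) → Irrelevant P →
                          Σ ℕ λ k → Σ (Fin N) P ↔ Fin k
decidable-subset-of-Fin zero _ _ = 0 , mk↔ₛ′ (λ ()) (λ ()) (λ ()) (λ ())
decidable-subset-of-Fin (suc N) {P} P? P-irr
  with decidable-subset-of-Fin N (λ i → P? (Fin.suc i)) P-irr | P? Fin.zero
... | k , e | yes p = suc k , mk↔ₛ′ to from to∘from from∘to
  where
  open Inverse e using ()
    renaming (to to toₑ; from to fromₑ; strictlyInverseˡ to toₑ∘fromₑ; strictlyInverseʳ to fromₑ∘toₑ)
  to : Σ (Fin (suc N)) P → Fin (suc k)
  to (Fin.zero , _) = Fin.zero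
  to (Fin.suc i , q) = Fin.suc (toₑ (i , q))
  from : Fin (suc k) → Σ (Fin (suc N)) P
  from Fin.zero = Fin.zero , p
  from (Fin.suc x) = let (i , q) = fromₑ x in Fin.suc i , q
  to∘from : ∀ x → to (from x) ≡ x
  to∘from Fin.zero = refl
  to∘from (Fin.suc x) = cong Fin.suc (toₑ∘fromₑ x)
  from∘to : ∀ a → from (to a) ≡ a
  from∘to (Fin.zero , q) = cong (Fin.zero ,_) (P-irr p q)
  from∘to (Fin.suc i , q) = cong (λ (i , q) → Fin.suc i , q) (fromₑ∘toₑ (i , q))
... | k , e | no ¬p = k , mk↔ₛ′ to from toₑ∘fromₑ from∘to
  where
  open Inverse e using ()
    renaming (to to toₑ; from to fromₑ; strictlyInverseˡ to toₑ∘fromₑ; strictlyInverseʳ to fromₑ∘toₑ)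
  to : Σ (Fin (suc N)) P → Fin k
  to (Fin.zero , q) = ⊥-elim (¬p q)
  to (Fin.suc i , q) = toₑ (i , q)
  from : Fin k → Σ (Fin (suc N)) P
  from x = let (i , q) = fromₑ x in Fin.suc i , q
  from∘to : ∀ a → from (to a) ≡ a
  from∘to (Fin.zero , q) = ⊥-elim (¬p q)
  from∘to (Fin.suc i , q) = cong (λ (i , q) → Fin.suc i , q) (fromₑ∘toₑ (i , q))

decidable-subset-finite : ∀ {A : Set} {N} → A ↔ Fin N → {P : A → Set} → (∀ a → Dec (P a)) → Irrelevant P →
                          Σ ℕ λ k → Σ A P ↔ Fin k
decidable-subset-finite {N = N} e {P} P? P-irr =
  let (k , sub↔Fin) = decidable-subset-of-Fin N (λ i → P? (from i)) P-irr
  in k , ↔-trans (restrict-↔ to from P-irr P-irr (subst P (sym (strictlyInverseʳ _))) (λ q → q)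
                   (λ {a} _ → strictlyInverseʳ a) (λ {b} _ → strictlyInverseˡ b))
                 sub↔Fin
  where open Inverse e

-- Weak compositions
module _ where
  open import Data.Nat using (_+_; _<_)
  open import Data.Nat.Combinatorics using (nCn≡1; nC1≡n; nCk+nC[k+1]≡[n+1]C[k+1])
  open import Data.Vec using (sum)
  open EquationalReasoning {k = bijection}

  WeakComposition : ℕ → ℕ → Set
  WeakComposition p s = Σ (Vec ℕ p) λ v → sum v ≡ s

  IsPointedComposition : ∀ k → ℕ → Vec ℕ (suc k) × ℕ → Set
  IsPointedComposition k s (v , j) = sum v ≡ s × j < suc (last v)

  PointedComposition : ℕ → ℕ → Set
  PointedComposition k s = Σ (Vec ℕ (suc k) × ℕ) (IsPointedComposition k s)

  sum≡0⇒replicate : ∀ {k} (v : Vec ℕ k) → sum v ≡ 0 → v ≡ replicate k 0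
  sum≡0⇒replicate [] _ = refl
  sum≡0⇒replicate (zero ∷ v) e = cong (0 ∷_) (sum≡0⇒replicate v e)

  sum-replicate-0 : ∀ k → sum (replicate k 0) ≡ 0
  sum-replicate-0 zero = refl
  sum-replicate-0 (suc k) = sum-replicate-0 k

  last-replicate : ∀ k (a : ℕ) → last (replicate (suc k) a) ≡ a
  last-replicate zero a = refl
  last-replicate (suc k) a = last-replicate k a

  singleton↔Fin1 : ∀ {A : Set} (x : A) → (∀ a → x ≡ a) → A ↔ Fin 1
  singleton↔Fin1 x x-unique = mk↔ₛ′ (λ _ → Fin.zero) (λ _ → x) (λ { Fin.zero → refl ; (Fin.suc ()) }) x-unique

  WeakComposition-split : ∀ p s →
    WeakComposition (suc (suc p)) (suc s) ↔ (WeakComposition (suc p) (suc s) ⊎ WeakComposition (suc (suc p)) s)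
  WeakComposition-split p s = mk↔ₛ′ to from to∘from from∘to
    where
    to : WeakComposition (suc (suc p)) (suc s) → WeakComposition (suc p) (suc s) ⊎ WeakComposition (suc (suc p)) s
    to (zero ∷ v , e) = inj₁ (v , e)
    to (suc a ∷ v , e) = inj₂ (a ∷ v , ℕP.suc-injective e)
    from : WeakComposition (suc p) (suc s) ⊎ WeakComposition (suc (suc p)) s → WeakComposition (suc (suc p)) (suc s)
    from (inj₁ (v , e)) = 0 ∷ v , e
    from (inj₂ (a ∷ v , e)) = suc a ∷ v , cong suc e
    to∘from : ∀ c → to (from c) ≡ c
    to∘from (inj₁ _) = refl
    to∘from (inj₂ (a ∷ v , e)) = cong (λ e → inj₂ (a ∷ v , e)) (uip _ _)
    from∘to : ∀ c → from (to c) ≡ c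
    from∘to (zero ∷ v , e) = refl
    from∘to (suc a ∷ v , e) = cong (suc a ∷ v ,_) (uip _ _)

  WeakComposition↔Fin : ∀ p s → WeakComposition (suc p) s ↔ Fin ((p + s) C p)
  WeakComposition↔Fin zero s =
    singleton↔Fin1 (s ∷ [] , ℕP.+-identityʳ s)
      (λ { (a ∷ [] , e) → Σ-≡-irrelevant uip (cong (_∷ []) (trans (sym e) (ℕP.+-identityʳ a))) })
  WeakComposition↔Fin (suc p) zero = begin
    WeakComposition (suc (suc p)) 0
      ↔⟨ singleton↔Fin1 (replicate (suc (suc p)) 0 , sum-replicate-0 (suc (suc p)))
           (λ (v , e) → Σ-≡-irrelevant uip (sym (sum≡0⇒replicate v e))) ⟩
    Fin 1                      ≡⟨ cong Fin (sym (nCn≡1 (suc p))) ⟩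
    Fin (suc p C suc p)        ≡⟨ cong (λ t → Fin (t C suc p)) (sym (ℕP.+-identityʳ (suc p))) ⟩
    Fin ((suc p + 0) C suc p)  ∎
  WeakComposition↔Fin (suc p) (suc s) = begin
    WeakComposition (suc (suc p)) (suc s)
      ↔⟨ WeakComposition-split p s ⟩
    (WeakComposition (suc p) (suc s) ⊎ WeakComposition (suc (suc p)) s)
      ↔⟨ WeakComposition↔Fin p (suc s) ⊎-↔ WeakComposition↔Fin (suc p) s ⟩
    (Fin ((p + suc s) C p) ⊎ Fin ((suc p + s) C suc p))
      ≡⟨ cong (λ t → Fin ((p + suc s) C p) ⊎ Fin (t C suc p)) (sym (ℕP.+-suc p s)) ⟩
    (Fin ((p + suc s) C p) ⊎ Fin ((p + suc s) C suc p))
      ↔⟨ FinP.+↔⊎ ⟨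
    Fin ((p + suc s) C p + (p + suc s) C suc p)
      ≡⟨ cong Fin (nCk+nC[k+1]≡[n+1]C[k+1] (p + suc s) p) ⟩
    Fin (suc (p + suc s) C suc p) ∎

  PointedComposition-split : ∀ k s →
    PointedComposition (suc k) (suc s) ↔ (PointedComposition k (suc s) ⊎ PointedComposition (suc k) s)
  PointedComposition-split k s = mk↔ₛ′ to from to∘from from∘to
    where
    to : PointedComposition (suc k) (suc s) → PointedComposition k (suc s) ⊎ PointedComposition (suc k) s
    to ((zero ∷ v , j) , e , j≤) = inj₁ ((v , j) , e , j≤)
    to ((suc a ∷ v , j) , e , j≤) = inj₂ ((a ∷ v , j) , ℕP.suc-injective e , j≤)
    from : PointedComposition k (suc s) ⊎ PointedComposition (suc k) s → PointedComposition (suc k) (suc s)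
    from (inj₁ ((v , j) , e , j≤)) = (0 ∷ v , j) , e , j≤
    from (inj₂ ((a ∷ v , j) , e , j≤)) = (suc a ∷ v , j) , cong suc e , j≤
    to∘from : ∀ c → to (from c) ≡ c
    to∘from (inj₁ _) = refl
    to∘from (inj₂ ((a ∷ v , j) , e , j≤)) = cong (λ e → inj₂ ((a ∷ v , j) , e , j≤)) (uip _ _)
    from∘to : ∀ c → from (to c) ≡ c
    from∘to ((zero ∷ v , j) , e , j≤) = refl
    from∘to ((suc a ∷ v , j) , e , j≤) = cong (λ e → (suc a ∷ v , j) , e , j≤) (uip _ _)

  IsPointedComposition-irrelevant : ∀ {k s} → Irrelevant (IsPointedComposition k s)
  IsPointedComposition-irrelevant (e , j≤) (e' , j≤') = cong₂ _,_ (uip e e') (ℕP.<-irrelevant j≤ j≤')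

  PointedComposition↔Fin : ∀ k s → PointedComposition k s ↔ Fin (suc (k + s) C suc k)
  PointedComposition↔Fin zero s = begin
    PointedComposition 0 s  ↔⟨ mk↔ₛ′ to from to∘from from∘to ⟩
    Fin (suc s)             ≡⟨ cong Fin (sym (nC1≡n (suc s))) ⟩
    Fin (suc s C 1)         ∎
    where
    to : PointedComposition 0 s → Fin (suc s)
    to ((a ∷ [] , j) , e , j≤a) = fromℕ< (subst (λ t → j < suc t) (trans (sym (ℕP.+-identityʳ a)) e) j≤a)
    from : Fin (suc s) → PointedComposition 0 s
    from i = (s ∷ [] , toℕ i) , ℕP.+-identityʳ s , FinP.toℕ<n i
    to∘from : ∀ i → to (from i) ≡ i
    to∘from i = FinP.fromℕ<-toℕ i _
    from∘to : ∀ c → from (to c) ≡ c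
    from∘to ((a ∷ [] , j) , e , j≤a) =
      Σ-≡-irrelevant (λ {c} → IsPointedComposition-irrelevant {x = c})
        (cong₂ _,_ (cong (_∷ []) (trans (sym e) (ℕP.+-identityʳ a))) (FinP.toℕ-fromℕ< _))
  PointedComposition↔Fin (suc k) zero = begin
    PointedComposition (suc k) 0
      ↔⟨ singleton↔Fin1 ((replicate (suc (suc k)) 0 , 0) , sum-replicate-0 (suc (suc k)) , s≤s z≤n) unique ⟩
    Fin 1                                  ≡⟨ cong Fin (sym (nCn≡1 (suc (suc k)))) ⟩
    Fin (suc (suc k) C suc (suc k))
      ≡⟨ cong (λ t → Fin (suc t C suc (suc k))) (sym (ℕP.+-identityʳ (suc k))) ⟩
    Fin (suc (suc k + 0) C suc (suc k))    ∎
    where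
    unique : ∀ c → ((replicate (suc (suc k)) 0 , 0) , sum-replicate-0 (suc (suc k)) , s≤s z≤n) ≡ c
    unique ((v , j) , e , j≤) with sum≡0⇒replicate v e
    ... | refl = Σ-≡-irrelevant (λ {c} → IsPointedComposition-irrelevant {x = c})
                   (cong (_ ,_) (sym (ℕP.n≤0⇒n≡0 (subst (j ℕ.≤_) (last-replicate (suc k) 0) (ℕP.≤-pred j≤)))))
  PointedComposition↔Fin (suc k) (suc s) = begin
    PointedComposition (suc k) (suc s)
      ↔⟨ PointedComposition-split k s ⟩
    (PointedComposition k (suc s) ⊎ PointedComposition (suc k) s)
      ↔⟨ PointedComposition↔Fin k (suc s) ⊎-↔ PointedComposition↔Fin (suc k) s ⟩
    (Fin (suc (k + suc s) C suc k) ⊎ Fin (suc (suc k + s) C suc (suc k)))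
      ≡⟨ cong (λ t → Fin (suc (k + suc s) C suc k) ⊎ Fin (suc t C suc (suc k))) (sym (ℕP.+-suc k s)) ⟩
    (Fin (suc (k + suc s) C suc k) ⊎ Fin (suc (k + suc s) C suc (suc k)))
      ↔⟨ FinP.+↔⊎ ⟨
    Fin (suc (k + suc s) C suc k + suc (k + suc s) C suc (suc k))
      ≡⟨ cong Fin (nCk+nC[k+1]≡[n+1]C[k+1] (suc (k + suc s)) (suc k)) ⟩
    Fin (suc (suc k + suc s) C suc (suc k)) ∎

module _ where
  open import Data.Integer using (ℤ; +_; _+_; _-_; _≤_; _<_; _≤?_; ∣_∣; +≤+; +<+)
  import Data.Integer.Properties as ℤP
  open import Data.Integer.Tactic.RingSolver using (solve-∀)
  open import Data.List using (List; []; _∷_; _++_; length; _∷ʳ_; initLast; _∷ʳ′_)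
  import Data.List.Properties as ListP
  open import Data.List.Relation.Unary.All as All using (All; []; _∷_)
  import Data.List.Relation.Unary.All.Properties as AllP
  open import Data.Unit using (⊤; tt)
  import Data.Vec.Relation.Unary.All as VecAll
  import Data.Vec.Relation.Unary.All.Properties as VecAllP
  import Data.Vec.Properties as VecP

  -- An inequality a ≤ b follows from hypotheses aᵢ ≤ bᵢ whose gaps bᵢ - aᵢ add up to b - a;
  -- the gap identity is a ring identity, proved by solve-∀ where it is used.
  ≤-from-gap : ∀ {a₁ b₁ a b} → a₁ ≤ b₁ → b₁ - a₁ ≡ b - a → a ≤ b
  ≤-from-gap h e = ℤP.0≤i-j⇒j≤i (subst (+ 0 ≤_) e (ℤP.i≤j⇒0≤j-i h))

  ≤-from-gaps₂ : ∀ {a₁ b₁ a₂ b₂ a b} → a₁ ≤ b₁ → a₂ ≤ b₂ → (b₁ - a₁) + (b₂ - a₂) ≡ b - a → a ≤ b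
  ≤-from-gaps₂ h₁ h₂ e =
    ℤP.0≤i-j⇒j≤i (subst (+ 0 ≤_) e (ℤP.+-mono-≤ (ℤP.i≤j⇒0≤j-i h₁) (ℤP.i≤j⇒0≤j-i h₂)))

  ≤-from-gaps₃ : ∀ {a₁ b₁ a₂ b₂ a₃ b₃ a b} → a₁ ≤ b₁ → a₂ ≤ b₂ → a₃ ≤ b₃ →
                 (b₁ - a₁) + (b₂ - a₂) + (b₃ - a₃) ≡ b - a → a ≤ b
  ≤-from-gaps₃ h₁ h₂ h₃ e = ℤP.0≤i-j⇒j≤i (subst (+ 0 ≤_) e
    (ℤP.+-mono-≤ (ℤP.+-mono-≤ (ℤP.i≤j⇒0≤j-i h₁) (ℤP.i≤j⇒0≤j-i h₂)) (ℤP.i≤j⇒0≤j-i h₃)))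

  1+i≰i : ∀ {i} → ¬ (+ 1 + i ≤ i)
  1+i≰i h = ℤP.<-irrefl refl (ℤP.suc[i]≤j⇒i<j h)

  0≤1 : + 0 ≤ + 1
  0≤1 = +≤+ z≤n

  -- Paths as lists of steps

  width : List Step → ℤ
  width [] = + 0
  width ((x , _) ∷ w) = x + width w

  rise : List Step → ℤ
  rise [] = + 0
  rise ((_ , y) ∷ w) = y + rise w

  width-++ : ∀ u v → width (u ++ v) ≡ width u + width v
  width-++ [] v = sym (ℤP.+-identityˡ (width v))
  width-++ ((x , _) ∷ u) v = trans (cong (λ t → x + t) (width-++ u v)) (sym (ℤP.+-assoc x (width u) (width v)))

  rise-++ : ∀ u v → rise (u ++ v) ≡ rise u + rise v
  rise-++ [] v = sym (ℤP.+-identityˡ (rise v))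
  rise-++ ((_ , y) ∷ u) v = trans (cong (λ t → y + t) (rise-++ u v)) (sym (ℤP.+-assoc y (rise u) (rise v)))

  Rightward : Step → Set
  Rightward (x , _) = + 1 ≤ x

  width-nonnegative : ∀ w → All Rightward w → + 0 ≤ width w
  width-nonnegative [] [] = ℤP.≤-refl
  width-nonnegative ((x , _) ∷ w) (1≤x ∷ rightward) =
    ≤-from-gaps₃ 1≤x (width-nonnegative w rightward) 0≤1 (ring x (width w))
    where
    ring : ∀ x s → (x - + 1) + (s - + 0) + (+ 1 - + 0) ≡ (x + s) - + 0
    ring = solve-∀

  points : ℤ → ℤ → List Step → List (ℤ × ℤ)
  points b a [] = []
  points b a ((x , y) ∷ w) = (b + x , a + y) ∷ points (b + x) (a + y) w

  rml : List Step → ℤ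
  rml w = rmlScan (+ 0) (+ 0) (points (+ 0) (+ 0) w)

  lastWidth : List Step → ℤ
  lastWidth [] = + 0
  lastWidth ((x , _) ∷ []) = x
  lastWidth (_ ∷ s ∷ w) = lastWidth (s ∷ w)

  lastWidth-++ : ∀ u s v → lastWidth (u ++ s ∷ v) ≡ lastWidth (s ∷ v)
  lastWidth-++ [] s v = refl
  lastWidth-++ (_ ∷ []) s v = refl
  lastWidth-++ (_ ∷ s′ ∷ u) s v = lastWidth-++ (s′ ∷ u) s v

  lastWidth≤width : ∀ s v → All Rightward (s ∷ v) → lastWidth (s ∷ v) ≤ width (s ∷ v)
  lastWidth≤width (x , _) [] _ = ℤP.≤-reflexive (sym (ℤP.+-identityʳ x))
  lastWidth≤width (x , _) (s′ ∷ v) (1≤x ∷ rightward) =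
    ≤-from-gaps₃ (lastWidth≤width s′ v rightward) 1≤x 0≤1 (ring (lastWidth (s′ ∷ v)) (width (s′ ∷ v)) x)
    where
    ring : ∀ l s x → (s - l) + (x - + 1) + (+ 1 - + 0) ≡ x + s - l
    ring = solve-∀

  -- NeverBelow c w: every point that w reaches from height 0 (after at least one step) has height ≥ c.
  NeverBelow : ℤ → List Step → Set
  NeverBelow c [] = ⊤
  NeverBelow c ((_ , y) ∷ w) = c ≤ y × NeverBelow (c - y) w

  NeverBelow-irrelevant : ∀ c w → Nullary.Irrelevant (NeverBelow c w)
  NeverBelow-irrelevant c [] tt tt = refl
  NeverBelow-irrelevant c ((_ , y) ∷ w) (c≤y , rest) (c≤y′ , rest′) =
    cong₂ _,_ (ℤP.≤-irrelevant c≤y c≤y′) (NeverBelow-irrelevant (c - y) w rest rest′)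

  NeverBelow-mono : ∀ {c d} w → d ≤ c → NeverBelow c w → NeverBelow d w
  NeverBelow-mono [] _ _ = tt
  NeverBelow-mono ((_ , y) ∷ w) d≤c (c≤y , rest) =
    ℤP.≤-trans d≤c c≤y , NeverBelow-mono w (ℤP.+-monoˡ-≤ _ d≤c) rest

  NeverBelow-++⁺ : ∀ {c} u v → NeverBelow c u → NeverBelow (c - rise u) v → NeverBelow c (u ++ v)
  NeverBelow-++⁺ {c} [] v _ below-v = subst (λ d → NeverBelow d v) (ℤP.+-identityʳ c) below-v
  NeverBelow-++⁺ {c} ((_ , y) ∷ u) v (c≤y , below-u) below-v =
    c≤y , NeverBelow-++⁺ u v below-u (subst (λ d → NeverBelow d v) (ring c y (rise u)) below-v)
    where
    ring : ∀ c y s → c - (y + s) ≡ c - y - s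
    ring = solve-∀

  NeverBelow-++⁻ : ∀ {c} u v → NeverBelow c (u ++ v) → NeverBelow c u × NeverBelow (c - rise u) v
  NeverBelow-++⁻ {c} [] v below = tt , subst (λ d → NeverBelow d v) (sym (ℤP.+-identityʳ c)) below
  NeverBelow-++⁻ {c} ((_ , y) ∷ u) v (c≤y , below) =
    let below-u , below-v = NeverBelow-++⁻ u v below
    in (c≤y , below-u) , subst (λ d → NeverBelow d v) (ring c y (rise u)) below-v
    where
    ring : ∀ c y s → c - y - s ≡ c - (y + s)
    ring = solve-∀

  NeverBelow⇒≤rise : ∀ {c} w → w ≢ [] → NeverBelow c w → c ≤ rise w
  NeverBelow⇒≤rise [] w≢[] _ = ⊥-elim (w≢[] refl)
  NeverBelow⇒≤rise ((_ , y) ∷ []) _ (c≤y , _) = ℤP.≤-trans c≤y (ℤP.≤-reflexive (sym (ℤP.+-identityʳ y)))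
  NeverBelow⇒≤rise {c} ((_ , y) ∷ s ∷ w) _ (_ , below) =
    ≤-from-gap (NeverBelow⇒≤rise (s ∷ w) (λ ()) below) (ring c y (rise (s ∷ w)))
    where
    ring : ∀ c y s → s - (c - y) ≡ (y + s) - c
    ring = solve-∀

  -- The rightmost minimum

  rmlScan-above : ∀ cb ca b a v → NeverBelow (ca - a + + 1) v → rmlScan cb ca (points b a v) ≡ cb
  rmlScan-above cb ca b a [] _ = refl
  rmlScan-above cb ca b a ((x , y) ∷ v) (above , rest) with a + y ≤? ca
  ... | yes a+y≤ca = ⊥-elim (1+i≰i {ca} (≤-from-gaps₂ above a+y≤ca (ring ca a y)))
    where
    ring : ∀ ca a y → (y - (ca - a + + 1)) + (ca - (a + y)) ≡ ca - (+ 1 + ca)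
    ring = solve-∀
  ... | no _ = rmlScan-above cb ca (b + x) (a + y) v (subst (λ c → NeverBelow c v) (ring ca a y) rest)
    where
    ring : ∀ ca a y → ca - a + + 1 - y ≡ ca - (a + y) + + 1
    ring = solve-∀

  rmlScan-split : ∀ x y u v cb ca b a → a + (y + rise u) ≤ ca →
                  NeverBelow (y + rise u) ((x , y) ∷ u) → NeverBelow (+ 1) v →
                  rmlScan cb ca (points b a ((x , y) ∷ u ++ v)) ≡ b + (x + width u)
  rmlScan-split x y u v cb ca b a end≤ca (y+s≤y , below-u) above-v with a + y ≤? ca
  rmlScan-split x y [] v cb ca b a end≤ca (y+s≤y , below-u) above-v | yes _ =
    trans (rmlScan-above (b + x) (a + y) (b + x) (a + y) v (subst (λ c → NeverBelow c v) (ring a y) above-v))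
          (cong (λ t → b + t) (sym (ℤP.+-identityʳ x)))
    where
    ring : ∀ a y → + 1 ≡ (a + y) - (a + y) + + 1
    ring = solve-∀
  rmlScan-split x y ((x′ , y′) ∷ u) v cb ca b a end≤ca (y+s≤y , below-u) above-v | yes _ =
    trans (rmlScan-split x′ y′ u v (b + x) (a + y) (b + x) (a + y)
             (≤-from-gap y+s≤y (ring₁ a y (y′ + rise u)))
             (subst (λ c → NeverBelow c ((x′ , y′) ∷ u)) (ring₂ y (y′ + rise u)) below-u) above-v)
          (ℤP.+-assoc b x (x′ + width u))
    where
    ring₁ : ∀ a y s → y - (y + s) ≡ (a + y) - ((a + y) + s)
    ring₁ = solve-∀
    ring₂ : ∀ y s → y + s - y ≡ s
    ring₂ = solve-∀
  rmlScan-split x y [] v cb ca b a end≤ca _ _ | no a+y≰ca =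
    ⊥-elim (a+y≰ca (subst (_≤ ca) (cong (λ t → a + t) (ℤP.+-identityʳ y)) end≤ca))
  rmlScan-split x y ((x′ , y′) ∷ u) v cb ca b a end≤ca (_ , below-u) above-v | no _ =
    trans (rmlScan-split x′ y′ u v cb ca (b + x) (a + y)
             (subst (_≤ ca) (sym (ℤP.+-assoc a y (y′ + rise u))) end≤ca)
             (subst (λ c → NeverBelow c ((x′ , y′) ∷ u)) (ring y (y′ + rise u)) below-u) above-v)
          (ℤP.+-assoc b x (x′ + width u))
    where
    ring : ∀ y s → y + s - y ≡ s
    ring = solve-∀

  -- The end of u is the rightmost minimum of u ++ v: it is no higher than the origin and than every
  -- point of u, and every point of v lies strictly above it.
  SplitsAtRightmostMin : List Step → List Step → Set
  SplitsAtRightmostMin u v = (rise u ≤ + 0) × NeverBelow (rise u) u × NeverBelow (+ 1) v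

  rml-split : ∀ u v → SplitsAtRightmostMin u v → rml (u ++ v) ≡ width u
  rml-split [] v (_ , _ , above-v) = rmlScan-above (+ 0) (+ 0) (+ 0) (+ 0) v above-v
  rml-split ((x , y) ∷ u) v (end≤0 , below-u , above-v) =
    trans (rmlScan-split x y u v (+ 0) (+ 0) (+ 0) (+ 0)
             (subst (_≤ + 0) (sym (ℤP.+-identityˡ (y + rise u))) end≤0) below-u above-v)
          (ℤP.+-identityˡ (x + width u))

  extendSplit : Step → List Step → List Step × List Step → List Step × List Step
  extendSplit (x , y) w (u , v) with y + rise u ≤? + 0
  ... | yes _ = (x , y) ∷ u , v
  ... | no _ = [] , (x , y) ∷ w

  splitAtRightmostMin : List Step → List Step × List Step
  splitAtRightmostMin [] = [] , []
  splitAtRightmostMin (s ∷ w) = extendSplit s w (splitAtRightmostMin w)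

  -- The last component, saying that the end of u is a minimum of the whole of w, carries the induction.
  SplitOf : List Step → List Step × List Step → Set
  SplitOf w (u , v) = (u ++ v ≡ w) × SplitsAtRightmostMin u v × NeverBelow (rise u) w

  extendSplit-spec : ∀ s w uv → SplitOf w uv → SplitOf (s ∷ w) (extendSplit s w uv)
  extendSplit-spec (x , y) w (u , v) (refl , (end≤0 , below-u , above-v) , below-w) with y + rise u ≤? + 0
  ... | yes y+end≤0 =
    refl , (y+end≤0 , (y+end≤y , subst (λ c → NeverBelow c u) (ring₁ y (rise u)) below-u) , above-v) ,
    (y+end≤y , subst (λ c → NeverBelow c (u ++ v)) (ring₁ y (rise u)) below-w)
    where
    ring₁ : ∀ y s → s ≡ (y + s) - y
    ring₁ = solve-∀
    ring₂ : ∀ y s → + 0 - s ≡ y - (y + s)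
    ring₂ = solve-∀
    y+end≤y : y + rise u ≤ y
    y+end≤y = ≤-from-gap end≤0 (ring₂ y (rise u))
  ... | no y+end≰0 = refl , (ℤP.≤-refl , tt , (1≤y , NeverBelow-mono (u ++ v) 1-y≤end below-w)) ,
                     (0≤y , NeverBelow-mono (u ++ v) -y≤end below-w)
    where
    1≤y+end : + 1 + + 0 ≤ y + rise u
    1≤y+end = ℤP.i<j⇒suc[i]≤j (ℤP.≰⇒> y+end≰0)
    1≤y : + 1 ≤ y
    1≤y = ≤-from-gaps₂ 1≤y+end end≤0 (ring y (rise u))
      where
      ring : ∀ y s → (y + s - (+ 1 + + 0)) + (+ 0 - s) ≡ y - + 1
      ring = solve-∀
    0≤y : + 0 ≤ y
    0≤y = ℤP.≤-trans 0≤1 1≤y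
    1-y≤end : + 1 - y ≤ rise u
    1-y≤end = ≤-from-gap 1≤y+end (ring y (rise u))
      where
      ring : ∀ y s → y + s - (+ 1 + + 0) ≡ s - (+ 1 - y)
      ring = solve-∀
    -y≤end : + 0 - y ≤ rise u
    -y≤end = ≤-from-gaps₂ 1≤y+end 0≤1 (ring y (rise u))
      where
      ring : ∀ y s → (y + s - (+ 1 + + 0)) + (+ 1 - + 0) ≡ s - (+ 0 - y)
      ring = solve-∀

  splitAtRightmostMin-spec : ∀ w → SplitOf w (splitAtRightmostMin w)
  splitAtRightmostMin-spec [] = refl , (ℤP.≤-refl , tt , tt) , tt
  splitAtRightmostMin-spec (s ∷ w) = extendSplit-spec s w (splitAtRightmostMin w) (splitAtRightmostMin-spec w)

  SplitsAtRightmostMin-∷ : ∀ x y u v → SplitsAtRightmostMin ((x , y) ∷ u) v → SplitsAtRightmostMin u v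
  SplitsAtRightmostMin-∷ x y u v (end≤0 , (y+end≤y , below-u) , above-v) =
    ≤-from-gap y+end≤y (ring₁ y (rise u)) , subst (λ c → NeverBelow c u) (ring₂ y (rise u)) below-u , above-v
    where
    ring₁ : ∀ y s → y - (y + s) ≡ + 0 - s
    ring₁ = solve-∀
    ring₂ : ∀ y s → (y + s) - y ≡ s
    ring₂ = solve-∀

  nonempty-prefix-above : ∀ s u v → NeverBelow (+ 1) (s ∷ u ++ v) → ¬ (rise (s ∷ u) ≤ + 0)
  nonempty-prefix-above s u v above end≤0 =
    1+i≰i (ℤP.≤-trans (NeverBelow⇒≤rise (s ∷ u) (λ ()) (proj₁ (NeverBelow-++⁻ (s ∷ u) v above))) end≤0)

  SplitsAtRightmostMin-unique : ∀ u v u′ v′ → u ++ v ≡ u′ ++ v′ →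
    SplitsAtRightmostMin u v → SplitsAtRightmostMin u′ v′ → u ≡ u′
  SplitsAtRightmostMin-unique [] v [] v′ _ _ _ = refl
  SplitsAtRightmostMin-unique [] v (s ∷ u′) v′ eq (_ , _ , above-v) (end≤0 , _) =
    ⊥-elim (nonempty-prefix-above s u′ v′ (subst (NeverBelow (+ 1)) eq above-v) end≤0)
  SplitsAtRightmostMin-unique (s ∷ u) v [] v′ eq (end≤0 , _) (_ , _ , above-v′) =
    ⊥-elim (nonempty-prefix-above s u v (subst (NeverBelow (+ 1)) (sym eq) above-v′) end≤0)
  SplitsAtRightmostMin-unique ((x , y) ∷ u) v ((x′ , y′) ∷ u′) v′ eq split split′ =
    cong₂ _∷_ (ListP.∷-injectiveˡ eq)
      (SplitsAtRightmostMin-unique u v u′ v′ (ListP.∷-injectiveʳ eq)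
        (SplitsAtRightmostMin-∷ x y u v split) (SplitsAtRightmostMin-∷ x′ y′ u′ v′ split′))

  -- Rotating to a positive path and back

  rotate : List Step × List Step → List Step
  rotate (u , v) = v ++ u

  rotate-NeverBelow : ∀ u v → SplitsAtRightmostMin u v → rise u + rise v ≡ + 1 → NeverBelow (+ 1) (v ++ u)
  rotate-NeverBelow u v (_ , below-u , above-v) total =
    NeverBelow-++⁺ v u above-v
      (subst (λ c → NeverBelow c u) (trans (ring (rise u) (rise v)) (cong (_- rise v) total)) below-u)
    where
    ring : ∀ a b → a ≡ a + b - b
    ring = solve-∀

  NeverBelow⇒SplitsAtRightmostMin : ∀ v u → v ≢ [] → NeverBelow (+ 1) (v ++ u) → rise v + rise u ≡ + 1 →
                                     SplitsAtRightmostMin u v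
  NeverBelow⇒SplitsAtRightmostMin v u v≢[] above total =
    ≤-from-gap (NeverBelow⇒≤rise v v≢[] above-v) (trans (cong (rise v -_) (sym total)) (ring₁ (rise v) (rise u))) ,
    subst (λ c → NeverBelow c u) (trans (cong (_- rise v) (sym total)) (ring₂ (rise v) (rise u))) above-u ,
    above-v
    where
    above-v = proj₁ (NeverBelow-++⁻ v u above)
    above-u = proj₂ (NeverBelow-++⁻ v u above)
    ring₁ : ∀ a b → a - (a + b) ≡ + 0 - b
    ring₁ = solve-∀
    ring₂ : ∀ a b → a + b - a ≡ b
    ring₂ = solve-∀

  splitAtRightmostMin-++ : ∀ u v → SplitsAtRightmostMin u v → splitAtRightmostMin (u ++ v) ≡ (u , v)
  splitAtRightmostMin-++ u v split with splitAtRightmostMin (u ++ v) | splitAtRightmostMin-spec (u ++ v)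
  ... | u′ , v′ | eq , split′ , _ with SplitsAtRightmostMin-unique u′ v′ u v eq split′ split
  ... | refl = cong (u ,_) (ListP.++-cancelˡ u v′ v eq)

  -- For 0 < t ≤ width Q, locate t Q = (a , s , b) cuts Q around the step s covering horizontal position t.
  Locates : ℤ → List Step → List Step × Step × List Step → Set
  Locates t Q (a , s , b) = (Q ≡ a ++ s ∷ b) × (+ 1 + width a ≤ t) × (t ≤ width a + proj₁ s)

  consLocated : Step → List Step × Step × List Step → List Step × Step × List Step
  consLocated s (a , r) = s ∷ a , r

  locate : ℤ → List Step → List Step × Step × List Step
  locate t [] = [] , (+ 0 , + 0) , []
  locate t ((x , y) ∷ Q) with t ≤? x
  ... | yes _ = [] , (x , y) , Q
  ... | no _ = consLocated (x , y) (locate (t - x) Q)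

  consLocated-spec : ∀ t x y Q asb → Locates (t - x) Q asb → Locates t ((x , y) ∷ Q) (consLocated (x , y) asb)
  consLocated-spec t x y Q (a , s , b) (eq , lower , upper) =
    cong ((x , y) ∷_) eq ,
    ≤-from-gap lower (ring₁ t x (width a)) ,
    ≤-from-gap upper (ring₂ t x (width a) (proj₁ s))
    where
    ring₁ : ∀ t x w → t - x - (+ 1 + w) ≡ t - (+ 1 + (x + w))
    ring₁ = solve-∀
    ring₂ : ∀ t x w z → w + z - (t - x) ≡ (x + w) + z - t
    ring₂ = solve-∀

  locate-spec : ∀ t Q → + 1 ≤ t → t ≤ width Q → Locates t Q (locate t Q)
  locate-spec t [] 1≤t t≤0 = ⊥-elim (1+i≰i {+ 0} (ℤP.≤-trans 1≤t t≤0))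
  locate-spec t ((x , y) ∷ Q) 1≤t t≤width with t ≤? x
  ... | yes t≤x = refl , 1≤t , subst (t ≤_) (sym (ℤP.+-identityˡ x)) t≤x
  ... | no t≰x = consLocated-spec t x y Q (locate (t - x) Q)
                   (locate-spec (t - x) Q (≤-from-gap x<t (ring₁ t x)) (≤-from-gap t≤width (ring₂ t x (width Q))))
    where
    x<t : + 1 + x ≤ t
    x<t = ℤP.i<j⇒suc[i]≤j (ℤP.≰⇒> t≰x)
    ring₁ : ∀ t x → t - (+ 1 + x) ≡ t - x - + 1
    ring₁ = solve-∀
    ring₂ : ∀ t x s → x + s - t ≡ s - (t - x)
    ring₂ = solve-∀

  locate-unique : ∀ t a s b → All Rightward a → + 1 + width a ≤ t → t ≤ width a + proj₁ s →
                  locate t (a ++ s ∷ b) ≡ (a , s , b)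
  locate-unique t [] (x , y) b _ _ t≤x with t ≤? x
  ... | yes _ = refl
  ... | no t≰x = ⊥-elim (t≰x (subst (t ≤_) (ℤP.+-identityˡ x) t≤x))
  locate-unique t ((x , y) ∷ a) s b (1≤x ∷ rightward) lower upper with t ≤? x
  ... | yes t≤x =
    ⊥-elim (1+i≰i {+ 0} (≤-from-gaps₃ lower t≤x (width-nonnegative a rightward) (ring t x (width a))))
    where
    ring : ∀ t x w → (t - (+ 1 + (x + w))) + (x - t) + (w - + 0) ≡ + 0 - (+ 1 + + 0)
    ring = solve-∀
  ... | no _ = cong (consLocated (x , y))
                 (locate-unique (t - x) a s b rightward
                   (≤-from-gap lower (ring₁ t x (width a))) (≤-from-gap upper (ring₂ t x (width a) (proj₁ s))))
    where
    ring₁ : ∀ t x w → t - (+ 1 + (x + w)) ≡ t - x - (+ 1 + w)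
    ring₁ = solve-∀
    ring₂ : ∀ t x w z → x + w + z - t ≡ w + z - (t - x)
    ring₂ = solve-∀

  IsPath : ℕ → ℕ → List Step → Set
  IsPath n m w = (length w ≡ suc n) × All (ValidStep n m) w × (width w ≡ + m) × (rise w ≡ + 1)

  ValidStep-irrelevant : ∀ n m → Irrelevant (ValidStep n m)
  ValidStep-irrelevant n m (a , b , c , d) (a′ , b′ , c′ , d′) =
    cong₂ _,_ (ℤP.≤-irrelevant a a′)
      (cong₂ _,_ (ℤP.≤-irrelevant b b′) (cong₂ _,_ (ℤP.≤-irrelevant c c′) (ℤP.≤-irrelevant d d′)))

  IsPath-irrelevant : ∀ {n m} → Irrelevant (IsPath n m)
  IsPath-irrelevant {n} {m} (a , b , c , d) (a′ , b′ , c′ , d′) =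
    cong₂ _,_ (uip a a′)
      (cong₂ _,_ (All.irrelevant (λ {s} → ValidStep-irrelevant n m {s}) b b′) (cong₂ _,_ (uip c c′) (uip d d′)))

  IsPath⇒Rightward : ∀ {n m w} → IsPath n m w → All Rightward w
  IsPath⇒Rightward (_ , valid , _) = All.map proj₁ valid

  IsPath⇒width≡m : ∀ {n m w} → IsPath n m w → width w ≡ + m
  IsPath⇒width≡m (_ , _ , width≡m , _) = width≡m

  IsPath⇒rise≡1 : ∀ {n m w} → IsPath n m w → rise w ≡ + 1
  IsPath⇒rise≡1 (_ , _ , _ , rise≡1) = rise≡1

  cut-position-bounds : ∀ {m r} → r ℕ.< m → + 1 ≤ + m - + r × + m - + r ≤ + m
  cut-position-bounds {m} {r} r<m =
    ≤-from-gap (+≤+ r<m) (ring₁ (+ r) (+ m)) , ≤-from-gap (+≤+ (z≤n {r})) (ring₂ (+ r) (+ m))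
    where
    ring₁ : ∀ r m → m - (+ 1 + r) ≡ m - r - + 1
    ring₁ = solve-∀
    ring₂ : ∀ r m → r - + 0 ≡ m - (m - r)
    ring₂ = solve-∀

  IsPath-rotate : ∀ {n m} u v → IsPath n m (u ++ v) → IsPath n m (v ++ u)
  IsPath-rotate u v (len , valid , w , r) =
    trans (ListP.length-++ v) (trans (ℕP.+-comm (length v) (length u)) (trans (sym (ListP.length-++ u)) len)) ,
    AllP.++⁺ (AllP.++⁻ʳ u valid) (AllP.++⁻ˡ u valid) ,
    trans (width-++ v u) (trans (ℤP.+-comm (width v) (width u)) (trans (sym (width-++ u v)) w)) ,
    trans (rise-++ v u) (trans (ℤP.+-comm (rise v) (rise u)) (trans (sym (rise-++ u v)) r))

  IsPointedWithPRML : ℕ → ℕ → ℕ → List Step × ℕ → Set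
  IsPointedWithPRML n m r (w , j) = IsPath n m w × (+ j < lastWidth w) × (rml w + + j ≡ + r)

  IsPointedWithPRML-irrelevant : ∀ {n m r} → Irrelevant (IsPointedWithPRML n m r)
  IsPointedWithPRML-irrelevant (a , b , c) (a′ , b′ , c′) =
    cong₂ _,_ (IsPath-irrelevant a a′) (cong₂ _,_ (ℤP.<-irrelevant b b′) (uip c c′))

  IsPositivePath : ℕ → ℕ → List Step → Set
  IsPositivePath n m Q = IsPath n m Q × NeverBelow (+ 1) Q

  IsPositivePath-irrelevant : ∀ {n m} → Irrelevant (IsPositivePath n m)
  IsPositivePath-irrelevant {x = Q} (a , b) (a′ , b′) =
    cong₂ _,_ (IsPath-irrelevant a a′) (NeverBelow-irrelevant (+ 1) Q b b′)

  toPositive : List Step → List Step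
  toPositive w = rotate (splitAtRightmostMin w)

  reassemble : ℤ → List Step × Step × List Step → List Step × ℕ
  reassemble t (a , s , b) = b ++ a ∷ʳ s , ∣ width a + proj₁ s - t ∣

  fromPositive : ℕ → ℕ → List Step → List Step × ℕ
  fromPositive m r Q = reassemble (+ m - + r) (locate (+ m - + r) Q)

  ∷ʳ≢[] : ∀ (a : List Step) s → a ∷ʳ s ≢ []
  ∷ʳ≢[] [] s ()
  ∷ʳ≢[] (_ ∷ a) s ()

  lastWidth-∷ʳ : ∀ u a s → lastWidth (u ++ a ∷ʳ s) ≡ proj₁ s
  lastWidth-∷ʳ u a s = trans (cong lastWidth (sym (ListP.++-assoc u a (s ∷ [])))) (lastWidth-++ (u ++ a) s [])

  module _ (n m : ℕ) where

    toPositive-positive : ∀ w → IsPath n m w → IsPositivePath n m (toPositive w)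
    toPositive-positive w path with splitAtRightmostMin w | splitAtRightmostMin-spec w
    ... | u , v | refl , split , _ =
      IsPath-rotate u v path , rotate-NeverBelow u v split (trans (sym (rise-++ u v)) (IsPath⇒rise≡1 path))

    fromPositive-of-split : ∀ u a s j r → IsPath n m (u ++ a ∷ʳ s) → SplitsAtRightmostMin u (a ∷ʳ s) →
                               + j < proj₁ s → width u + + j ≡ + r →
                               fromPositive m r ((a ∷ʳ s) ++ u) ≡ (u ++ a ∷ʳ s , j)
    fromPositive-of-split u a s j r path split j<x r≡ =
      trans (cong (reassemble t) located)
            (cong (u ++ a ∷ʳ s ,_) (cong ∣_∣ (trans (cong (A + x -_) t≡) (ring₃ A x (+ j)))))
      where
      A = width a
      x = proj₁ s
      t = + m - + r
      t≡ : t ≡ A + x - + j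
      t≡ = begin
        + m - + r                            ≡⟨ cong₂ _-_ (sym (IsPath⇒width≡m path)) (sym r≡) ⟩
        width (u ++ a ∷ʳ s) - (width u + + j) ≡⟨ cong (_- (width u + + j)) (width-++ u (a ∷ʳ s)) ⟩
        width u + width (a ∷ʳ s) - (width u + + j)
          ≡⟨ cong (λ z → width u + z - (width u + + j)) (width-++ a (s ∷ [])) ⟩
        width u + (A + (x + + 0)) - (width u + + j) ≡⟨ ring (width u) A x (+ j) ⟩
        A + x - + j ∎
        where
        open ≡-Reasoning
        ring : ∀ W A x j → W + (A + (x + + 0)) - (W + j) ≡ A + x - j
        ring = solve-∀
      lower : + 1 + A ≤ t
      lower = subst (+ 1 + A ≤_) (sym t≡) (≤-from-gap (ℤP.i<j⇒suc[i]≤j j<x) (ring₁ A x (+ j)))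
        where
        ring₁ : ∀ A x j → x - (+ 1 + j) ≡ A + x - j - (+ 1 + A)
        ring₁ = solve-∀
      upper : t ≤ A + x
      upper = subst (_≤ A + x) (sym t≡) (≤-from-gap (+≤+ (z≤n {j})) (ring₂ A x (+ j)))
        where
        ring₂ : ∀ A x j → j - + 0 ≡ A + x - (A + x - j)
        ring₂ = solve-∀
      located : locate t ((a ∷ʳ s) ++ u) ≡ (a , s , u)
      located = trans (cong (locate t) (ListP.++-assoc a (s ∷ []) u))
        (locate-unique t a s u (AllP.++⁻ˡ a (AllP.++⁻ʳ u (IsPath⇒Rightward path))) lower upper)
      ring₃ : ∀ A x j → A + x - (A + x - j) ≡ j
      ring₃ = solve-∀

    split-nonempty : ∀ u → IsPath n m (u ++ []) → ¬ SplitsAtRightmostMin u []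
    split-nonempty u (_ , _ , _ , rise≡1) (end≤0 , _) =
      1+i≰i {+ 0} (subst (_≤ + 0) (trans (cong rise (sym (ListP.++-identityʳ u))) rise≡1) end≤0)

    fromPositive-toPositive : ∀ w j r → IsPointedWithPRML n m r (w , j) → fromPositive m r (toPositive w) ≡ (w , j)
    fromPositive-toPositive w j r (path , j<last , prml≡r) with splitAtRightmostMin w | splitAtRightmostMin-spec w
    ... | u , v | refl , split , _ with initLast v
    ... | [] = ⊥-elim (split-nonempty u path split)
    ... | a ∷ʳ′ s = fromPositive-of-split u a s j r path split
                      (subst (+ j <_) (lastWidth-∷ʳ u a s) j<last)
                      (trans (cong (_+ + j) (sym (rml-split u (a ∷ʳ s) split))) prml≡r)

    reassemble-spec : ∀ r Q asb → IsPositivePath n m Q → Locates (+ m - + r) Q asb →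
                      IsPointedWithPRML n m r (reassemble (+ m - + r) asb) ×
                      toPositive (proj₁ (reassemble (+ m - + r) asb)) ≡ Q
    reassemble-spec r .(a ++ s ∷ b) (a , s , b) (path , above) (refl , lower , upper) =
      (IsPath-rotate (a ∷ʳ s) b path′ , j<x , prml≡r) ,
      trans (cong rotate (splitAtRightmostMin-++ b (a ∷ʳ s) split)) assoc
      where
      A = width a
      x = proj₁ s
      t = + m - + r
      assoc : (a ∷ʳ s) ++ b ≡ a ++ s ∷ b
      assoc = ListP.++-assoc a (s ∷ []) b
      path′ : IsPath n m ((a ∷ʳ s) ++ b)
      path′ = subst (IsPath n m) (sym assoc) path
      split : SplitsAtRightmostMin b (a ∷ʳ s)
      split = NeverBelow⇒SplitsAtRightmostMin (a ∷ʳ s) b (∷ʳ≢[] a s) (subst (NeverBelow (+ 1)) (sym assoc) above)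
                (trans (sym (rise-++ (a ∷ʳ s) b)) (IsPath⇒rise≡1 path′))
      j≡ : + ∣ A + x - t ∣ ≡ A + x - t
      j≡ = ℤP.0≤i⇒+∣i∣≡i (≤-from-gap upper (ring A x t))
        where
        ring : ∀ A x t → A + x - t ≡ A + x - t - + 0
        ring = solve-∀
      j<x : + ∣ A + x - t ∣ < lastWidth (b ++ a ∷ʳ s)
      j<x = subst₂ _<_ (sym j≡) (sym (lastWidth-∷ʳ b a s)) (ℤP.suc[i]≤j⇒i<j (≤-from-gap lower (ring A x t)))
        where
        ring : ∀ A x t → t - (+ 1 + A) ≡ x - (+ 1 + (A + x - t))
        ring = solve-∀
      m≡ : + m ≡ A + (x + width b)
      m≡ = trans (sym (IsPath⇒width≡m path)) (width-++ a (s ∷ b))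
      prml≡r : rml (b ++ a ∷ʳ s) + + ∣ A + x - t ∣ ≡ + r
      prml≡r = begin
        rml (b ++ a ∷ʳ s) + + ∣ A + x - t ∣  ≡⟨ cong₂ _+_ (rml-split b (a ∷ʳ s) split) j≡ ⟩
        width b + (A + x - (+ m - + r))     ≡⟨ cong (λ z → width b + (A + x - (z - + r))) m≡ ⟩
        width b + (A + x - (A + (x + width b) - + r)) ≡⟨ ring (width b) A x (+ r) ⟩
        + r ∎
        where
        open ≡-Reasoning
        ring : ∀ B A x r → B + (A + x - (A + (x + B) - r)) ≡ r
        ring = solve-∀

    fromPositive-spec : ∀ r Q → r ℕ.< m → IsPositivePath n m Q →
                        IsPointedWithPRML n m r (fromPositive m r Q) × toPositive (proj₁ (fromPositive m r Q)) ≡ Q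
    fromPositive-spec r Q r<m positive@(path , _) =
      reassemble-spec r Q (locate (+ m - + r) Q) positive
        (locate-spec (+ m - + r) Q 1≤t (subst (+ m - + r ≤_) (sym (IsPath⇒width≡m path)) t≤m))
      where
      1≤t = proj₁ (cut-position-bounds r<m)
      t≤m = proj₂ (cut-position-bounds r<m)

    PRML-range : ∀ w j → IsPath n m w → + j < lastWidth w → + 0 ≤ rml w + + j × rml w + + j < + m
    PRML-range w j path j<last with splitAtRightmostMin w | splitAtRightmostMin-spec w
    ... | u , [] | refl , split , _ = ⊥-elim (split-nonempty u path split)
    ... | u , s ∷ v | refl , split , _ =
      subst (λ z → + 0 ≤ z + + j) (sym rml≡) (ℤP.+-mono-≤ (width-nonnegative u rightward-u) (+≤+ z≤n)) ,
      subst (λ z → z + + j < + m) (sym rml≡)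
        (ℤP.suc[i]≤j⇒i<j (subst (+ 1 + (width u + + j) ≤_) (sym m≡) below-m))
      where
      rightward-u = AllP.++⁻ˡ u (IsPath⇒Rightward path)
      rightward-v = AllP.++⁻ʳ u (IsPath⇒Rightward path)
      rml≡ : rml (u ++ s ∷ v) ≡ width u
      rml≡ = rml-split u (s ∷ v) split
      m≡ : + m ≡ width u + width (s ∷ v)
      m≡ = trans (sym (IsPath⇒width≡m path)) (width-++ u (s ∷ v))
      below-m : + 1 + (width u + + j) ≤ width u + width (s ∷ v)
      below-m = ≤-from-gaps₂ (ℤP.i<j⇒suc[i]≤j (subst (+ j <_) (lastWidth-++ u s v) j<last))
                  (lastWidth≤width s v rightward-v)
                  (ring (width u) (+ j) (lastWidth (s ∷ v)) (width (s ∷ v)))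
        where
        ring : ∀ U J L S → (L - (+ 1 + J)) + (S - L) ≡ (U + S) - (+ 1 + (U + J))
        ring = solve-∀

    PositivePath : Set
    PositivePath = Σ (List Step) (IsPositivePath n m)

    PointedListPath : ℕ → Set
    PointedListPath r = Σ (List Step × ℕ) (IsPointedWithPRML n m r)

    PointedListPath↔PositivePath : ∀ r → r ℕ.< m → PointedListPath r ↔ PositivePath
    PointedListPath↔PositivePath r r<m =
      restrict-↔ (λ (w , _) → toPositive w) (fromPositive m r) IsPointedWithPRML-irrelevant IsPositivePath-irrelevant
        (λ {(w , _)} (path , _) → toPositive-positive w path)
        (λ {Q} positive → proj₁ (fromPositive-spec r Q r<m positive))
        (λ {(w , j)} pointed → fromPositive-toPositive w j r pointed)
        (λ {Q} positive → proj₂ (fromPositive-spec r Q r<m positive))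

  -- Pads with (0 , 0) or truncates; only ever applied to lists of length k.
  toVec : ∀ k → List Step → Vec Step k
  toVec zero _ = []
  toVec (suc k) [] = (+ 0 , + 0) ∷ toVec k []
  toVec (suc k) (s ∷ w) = s ∷ toVec k w

  toVec-toList : ∀ {k} (v : Vec Step k) → toVec k (Vec.toList v) ≡ v
  toVec-toList [] = refl
  toVec-toList (s ∷ v) = cong (s ∷_) (toVec-toList v)

  toList-toVec : ∀ k w → length w ≡ k → Vec.toList (toVec k w) ≡ w
  toList-toVec zero [] _ = refl
  toList-toVec (suc k) (s ∷ w) len = cong (s ∷_) (toList-toVec k w (ℕP.suc-injective len))

  sumX≡width : ∀ {k} (v : Vec Step k) → sumX v ≡ width (Vec.toList v)
  sumX≡width [] = refl
  sumX≡width ((x , _) ∷ v) = cong (λ t → x + t) (sumX≡width v)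

  sumY≡rise : ∀ {k} (v : Vec Step k) → sumY v ≡ rise (Vec.toList v)
  sumY≡rise [] = refl
  sumY≡rise ((_ , y) ∷ v) = cong (λ t → y + t) (sumY≡rise v)

  pointsFrom≡points : ∀ {k} b a (v : Vec Step k) → pointsFrom b a v ≡ points b a (Vec.toList v)
  pointsFrom≡points b a [] = refl
  pointsFrom≡points b a ((x , y) ∷ v) = cong ((b + x , a + y) ∷_) (pointsFrom≡points (b + x) (a + y) v)

  last≡lastWidth : ∀ {k} (v : Vec Step (suc k)) → proj₁ (last v) ≡ lastWidth (Vec.toList v)
  last≡lastWidth (_ ∷ []) = refl
  last≡lastWidth (_ ∷ s ∷ v) = last≡lastWidth (s ∷ v)

  module _ (n m : ℕ) where

    IsLatticePath : Vec Step (suc n) → Set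
    IsLatticePath v = VecAll.All (ValidStep n m) v × (sumX v ≡ + m) × (sumY v ≡ + 1)

    IsLatticePath-irrelevant : Irrelevant IsLatticePath
    IsLatticePath-irrelevant (a , b , c) (a′ , b′ , c′) =
      cong₂ _,_ (VecAll.irrelevant (λ {s} → ValidStep-irrelevant n m {s}) a a′) (cong₂ _,_ (uip b b′) (uip c c′))

    IsLatticePath⇒IsPath : ∀ {v} → IsLatticePath v → IsPath n m (Vec.toList v)
    IsLatticePath⇒IsPath {v} (valid , sumX≡m , sumY≡1) =
      VecP.length-toList v , VecAllP.toList⁺ valid ,
      trans (sym (sumX≡width v)) sumX≡m , trans (sym (sumY≡rise v)) sumY≡1

    IsPath⇒IsLatticePath : ∀ {w} → IsPath n m w → IsLatticePath (toVec (suc n) w)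
    IsPath⇒IsLatticePath {w} (len , valid , width≡m , rise≡1) =
      VecAllP.toList⁻ (subst (All (ValidStep n m)) (sym w≡) valid) ,
      trans (sumX≡width (toVec (suc n) w)) (trans (cong width w≡) width≡m) ,
      trans (sumY≡rise (toVec (suc n) w)) (trans (cong rise w≡) rise≡1)
      where
      w≡ = toList-toVec (suc n) w len

    RML≡rml : (P : LatticePath n m) → RML P ≡ rml (Vec.toList (proj₁ P))
    RML≡rml (v , _) = cong (rmlScan (+ 0) (+ 0)) (pointsFrom≡points (+ 0) (+ 0) v)

    IsPointedVec : Vec Step (suc n) × ℕ → Set
    IsPointedVec (v , j) = Σ (IsLatticePath v) λ path → + j < lastX (v , path)

    IsPointedVecWithPRML : ℕ → Vec Step (suc n) × ℕ → Set
    IsPointedVecWithPRML r (v , j) =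
      Σ (IsLatticePath v) λ path → (+ j < lastX (v , path)) × (RML (v , path) + + j ≡ + r)

    IsPointedVec-irrelevant : Irrelevant IsPointedVec
    IsPointedVec-irrelevant (path , j<) (path′ , j<′) with IsLatticePath-irrelevant path path′
    ... | refl = cong (path ,_) (ℤP.<-irrelevant j< j<′)

    IsPointedVecWithPRML-irrelevant : ∀ {r} → Irrelevant (IsPointedVecWithPRML r)
    IsPointedVecWithPRML-irrelevant (path , j< , prml) (path′ , j<′ , prml′) with IsLatticePath-irrelevant path path′
    ... | refl = cong₂ (λ j< prml → path , j< , prml) (ℤP.<-irrelevant j< j<′) (uip prml prml′)

    PointedPath-reassoc : PointedPath n m ↔ Σ (Vec Step (suc n) × ℕ) IsPointedVec
    PointedPath-reassoc =
      mk↔ₛ′ (λ ((v , path) , j , j<) → (v , j) , path , j<) (λ ((v , j) , path , j<) → (v , path) , j , j<)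
            (λ _ → refl) (λ _ → refl)

    PointedWithPRML-reassoc : ∀ r → PointedWithPRML n m r ↔ Σ (Vec Step (suc n) × ℕ) (IsPointedVecWithPRML r)
    PointedWithPRML-reassoc r =
      mk↔ₛ′ (λ (((v , path) , j , j<) , prml) → (v , j) , path , j< , prml)
            (λ ((v , j) , path , j< , prml) → ((v , path) , j , j<) , prml)
            (λ _ → refl) (λ _ → refl)

    PointedWithPRML↔PointedListPath : ∀ r → PointedWithPRML n m r ↔ PointedListPath n m r
    PointedWithPRML↔PointedListPath r = ↔-trans (PointedWithPRML-reassoc r)
      (restrict-↔ (λ (v , j) → Vec.toList v , j) (λ (w , j) → toVec (suc n) w , j)
        IsPointedVecWithPRML-irrelevant IsPointedWithPRML-irrelevant
        (λ {(v , j)} (path , j< , prml) →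
           IsLatticePath⇒IsPath path , subst (+ j <_) (last≡lastWidth v) j< ,
           trans (cong (_+ + j) (sym (RML≡rml (v , path)))) prml)
        (λ {(w , j)} (path , j< , prml) → let w≡ = toList-toVec (suc n) w (proj₁ path) in
           IsPath⇒IsLatticePath path ,
           subst (+ j <_) (sym (trans (last≡lastWidth (toVec (suc n) w)) (cong lastWidth w≡))) j< ,
           trans (cong (_+ + j) (trans (RML≡rml (toVec (suc n) w , IsPath⇒IsLatticePath path)) (cong rml w≡))) prml)
        (λ {(v , j)} _ → cong (_, j) (toVec-toList v))
        (λ {(w , j)} (path , _) → cong (_, j) (toList-toVec (suc n) w (proj₁ path))))

    PointedWithPRML↔PositivePath : ∀ r → r ℕ.< m → PointedWithPRML n m r ↔ PositivePath n m
    PointedWithPRML↔PositivePath r r<m =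
      ↔-trans (PointedWithPRML↔PointedListPath r) (PointedListPath↔PositivePath n m r r<m)

    PRML-bounds : (p : PointedPath n m) → + 0 ≤ PRML p × PRML p < + m
    PRML-bounds ((v , path) , j , j<) =
      subst (λ z → + 0 ≤ z + + j × z + + j < + m) (sym (RML≡rml (v , path)))
        (PRML-range n m (Vec.toList v) j (IsLatticePath⇒IsPath path) (subst (+ j <_) (last≡lastWidth v) j<))

    prmlIndex : PointedPath n m → Fin m
    prmlIndex p = let lower , upper = PRML-bounds p in
      fromℕ< (ℤP.drop‿+<+ (subst (_< + m) (sym (ℤP.0≤i⇒+∣i∣≡i lower)) upper))

    PRML≡prmlIndex : ∀ p → PRML p ≡ + toℕ (prmlIndex p)
    PRML≡prmlIndex p =
      trans (sym (ℤP.0≤i⇒+∣i∣≡i (proj₁ (PRML-bounds p)))) (cong +_ (sym (FinP.toℕ-fromℕ< _)))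

    PointedPath↔PRML-fibres : PointedPath n m ↔ Σ (Fin m) (λ r → PointedWithPRML n m (toℕ r))
    PointedPath↔PRML-fibres = mk↔ₛ′ to (λ (_ , p , _) → p) to∘from (λ _ → refl)
      where
      to : PointedPath n m → Σ (Fin m) (λ r → PointedWithPRML n m (toℕ r))
      to p = prmlIndex p , p , PRML≡prmlIndex p
      to∘from : ∀ c → to (proj₁ (proj₂ c)) ≡ c
      to∘from (r , p , prml≡r) =
        same-fibre (FinP.toℕ-injective (ℤP.+-injective (trans (sym (PRML≡prmlIndex p)) prml≡r)))
        where
        same-fibre : ∀ {i} → i ≡ r → {prml≡i : PRML p ≡ + toℕ i} → (i , p , prml≡i) ≡ (r , p , prml≡r)
        same-fibre refl = cong (λ e → r , p , e) (uip _ _)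

    PointedWithPRML-finite : ∀ {N} r → PointedPath n m ↔ Fin N → Σ ℕ λ k → PointedWithPRML n m r ↔ Fin k
    PointedWithPRML-finite r pointed↔Fin = decidable-subset-finite pointed↔Fin (λ p → PRML p ℤP.≟ + r) uip

  -- Counting pointed paths

  -- Every valid step is (1 + a , 1 - z) with a, z ∈ ℕ.
  mkStep : ℕ → ℕ → Step
  mkStep z a = + suc a , + 1 - + z

  heightDrops : ∀ {k} → Vec Step k → Vec ℕ k
  heightDrops = Vec.map (λ (_ , y) → ∣ + 1 - y ∣)

  extraWidths : ∀ {k} → Vec Step k → Vec ℕ k
  extraWidths = Vec.map (λ (x , _) → ∣ x - + 1 ∣)

  heightDrops-zipWith : ∀ {k} (zs as : Vec ℕ k) → heightDrops (Vec.zipWith mkStep zs as) ≡ zs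
  heightDrops-zipWith [] [] = refl
  heightDrops-zipWith (z ∷ zs) (a ∷ as) = cong₂ _∷_ (cong ∣_∣ (ring (+ z))) (heightDrops-zipWith zs as)
    where
    ring : ∀ z → + 1 - (+ 1 - z) ≡ z
    ring = solve-∀

  extraWidths-zipWith : ∀ {k} (zs as : Vec ℕ k) → extraWidths (Vec.zipWith mkStep zs as) ≡ as
  extraWidths-zipWith [] [] = refl
  extraWidths-zipWith (z ∷ zs) (a ∷ as) = cong (a ∷_) (extraWidths-zipWith zs as)

  sumX-zipWith : ∀ {k} (zs as : Vec ℕ k) → sumX (Vec.zipWith mkStep zs as) ≡ + k + + Vec.sum as
  sumX-zipWith [] [] = refl
  sumX-zipWith {suc k} (z ∷ zs) (a ∷ as) =
    trans (cong (λ t → + suc a + t) (sumX-zipWith zs as)) (ring (+ a) (+ k) (+ Vec.sum as))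
    where
    ring : ∀ a k s → (+ 1 + a) + (k + s) ≡ (+ 1 + k) + (a + s)
    ring = solve-∀

  sumY-zipWith : ∀ {k} (zs as : Vec ℕ k) → sumY (Vec.zipWith mkStep zs as) ≡ + k - + Vec.sum zs
  sumY-zipWith [] [] = refl
  sumY-zipWith {suc k} (z ∷ zs) (a ∷ as) =
    trans (cong (λ t → (+ 1 - + z) + t) (sumY-zipWith zs as)) (ring (+ z) (+ k) (+ Vec.sum zs))
    where
    ring : ∀ z k s → (+ 1 - z) + (k - s) ≡ (+ 1 + k) - (z + s)
    ring = solve-∀

  last-zipWith : ∀ {k} (zs as : Vec ℕ (suc k)) → proj₁ (last (Vec.zipWith mkStep zs as)) ≡ + suc (last as)
  last-zipWith (_ ∷ []) (_ ∷ []) = refl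
  last-zipWith (_ ∷ z ∷ zs) (_ ∷ a ∷ as) = last-zipWith (z ∷ zs) (a ∷ as)

  ≤-sum : ∀ {k} (v : Vec ℕ k) → VecAll.All (ℕ._≤ Vec.sum v) v
  ≤-sum [] = VecAll.[]
  ≤-sum (a ∷ v) =
    ℕP.m≤m+n a (Vec.sum v) VecAll.∷ VecAll.map (λ h → ℕP.≤-trans h (ℕP.m≤n+m (Vec.sum v) a)) (≤-sum v)

  mkStep-inverse : ∀ {n m} x y → ValidStep n m (x , y) → mkStep ∣ + 1 - y ∣ ∣ x - + 1 ∣ ≡ (x , y)
  mkStep-inverse x y (1≤x , _ , _ , y≤1) =
    cong₂ _,_ (trans (cong (λ t → + 1 + t) (ℤP.0≤i⇒+∣i∣≡i (ℤP.i≤j⇒0≤j-i 1≤x))) (ring₁ x))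
              (trans (cong (λ t → + 1 - t) (ℤP.0≤i⇒+∣i∣≡i (ℤP.i≤j⇒0≤j-i y≤1))) (ring₂ y))
    where
    ring₁ : ∀ x → + 1 + (x - + 1) ≡ x
    ring₁ = solve-∀
    ring₂ : ∀ y → + 1 - (+ 1 - y) ≡ y
    ring₂ = solve-∀

  zipWith-inverse : ∀ {n m k} (v : Vec Step k) → VecAll.All (ValidStep n m) v →
                    Vec.zipWith mkStep (heightDrops v) (extraWidths v) ≡ v
  zipWith-inverse [] _ = refl
  zipWith-inverse {n} {m} ((x , y) ∷ v) (valid VecAll.∷ valids) =
    cong₂ _∷_ (mkStep-inverse {n} {m} x y valid) (zipWith-inverse {n} {m} v valids)

  module _ {n m : ℕ} (1≤n : 1 ℕ.≤ n) (n<m : suc n ℕ.≤ m) where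

    mkStep-valid : ∀ {z a} → z ℕ.≤ n → a ℕ.≤ m ∸ suc n → ValidStep n m (mkStep z a)
    mkStep-valid {z} {a} z≤ a≤ =
      +≤+ (s≤s z≤n) , ≤-from-gap (+≤+ a+2≤m) (ring (+ suc a) (+ m)) ,
      ≤-from-gap (+≤+ z≤) (ring₁ (+ n) (+ z)) , ≤-from-gap (+≤+ (z≤n {z})) (ring₂ (+ z))
      where
      a+2≤m : suc a ℕ.+ 1 ℕ.≤ m
      a+2≤m = begin
        suc a ℕ.+ 1       ≡⟨ ℕP.+-suc a 1 ⟨
        a ℕ.+ 2           ≤⟨ ℕP.+-monoʳ-≤ a (s≤s 1≤n) ⟩
        a ℕ.+ suc n       ≤⟨ ℕP.+-monoˡ-≤ (suc n) a≤ ⟩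
        m ∸ suc n ℕ.+ suc n ≡⟨ ℕP.m∸n+n≡m n<m ⟩
        m                 ∎
        where open ℕP.≤-Reasoning
      ring : ∀ x m → m - (x + + 1) ≡ m - + 1 - x
      ring = solve-∀
      ring₁ : ∀ n z → n - z ≡ (+ 1 - z) - (+ 1 - n)
      ring₁ = solve-∀
      ring₂ : ∀ z → z - + 0 ≡ + 1 - (+ 1 - z)
      ring₂ = solve-∀

    zipWith-valid : ∀ {k} (zs as : Vec ℕ k) → VecAll.All (ℕ._≤ n) zs → VecAll.All (ℕ._≤ m ∸ suc n) as →
                    VecAll.All (ValidStep n m) (Vec.zipWith mkStep zs as)
    zipWith-valid [] [] _ _ = VecAll.[]
    zipWith-valid (z ∷ zs) (a ∷ as) (z≤ VecAll.∷ zs≤) (a≤ VecAll.∷ as≤) =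
      mkStep-valid z≤ a≤ VecAll.∷ zipWith-valid zs as zs≤ as≤

    IsCompositionPair : (Vec ℕ (suc n) × Vec ℕ (suc n)) × ℕ → Set
    IsCompositionPair ((zs , as) , j) = Vec.sum zs ≡ n × Vec.sum as ≡ m ∸ suc n × j ℕ.< suc (last as)

    -- Σ y = 1 and Σ x = m say exactly that the drops sum to n and the extra widths to m - n - 1,
    -- and these sums already force the bounds of ValidStep.
    composition-of-path : ∀ zs as j → IsPointedVec n m (Vec.zipWith mkStep zs as , j) → IsCompositionPair ((zs , as) , j)
    composition-of-path zs as j ((_ , sumX≡m , sumY≡1) , j<) =
      sum-zs , sum-as , ℤP.drop‿+<+ (subst (+ j <_) (last-zipWith zs as) j<)
      where
      sum-zs : Vec.sum zs ≡ n
      sum-zs = ℤP.+-injective (begin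
        + Vec.sum zs                        ≡⟨ ring₁ (+ n) (+ Vec.sum zs) ⟩
        + suc n - (+ suc n - + Vec.sum zs)  ≡⟨ cong (+ suc n -_) (trans (sym (sumY-zipWith zs as)) sumY≡1) ⟩
        + suc n - + 1                       ≡⟨ ring₂ (+ n) ⟩
        + n                                 ∎)
        where
        open ≡-Reasoning
        ring₁ : ∀ n z → z ≡ (+ 1 + n) - ((+ 1 + n) - z)
        ring₁ = solve-∀
        ring₂ : ∀ n → (+ 1 + n) - + 1 ≡ n
        ring₂ = solve-∀
      sum-as : Vec.sum as ≡ m ∸ suc n
      sum-as = trans (sym (ℕP.m+n∸m≡n (suc n) (Vec.sum as)))
                     (cong (_∸ suc n) (ℤP.+-injective (trans (sym (sumX-zipWith zs as)) sumX≡m)))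

    path-of-composition : ∀ zs as j → IsCompositionPair ((zs , as) , j) → IsPointedVec n m (Vec.zipWith mkStep zs as , j)
    path-of-composition zs as j (sum-zs , sum-as , j<) =
      (zipWith-valid zs as (subst (λ t → VecAll.All (ℕ._≤ t) zs) sum-zs (≤-sum zs))
                           (subst (λ t → VecAll.All (ℕ._≤ t) as) sum-as (≤-sum as)) ,
       trans (sumX-zipWith zs as) (cong +_ (trans (cong (suc n ℕ.+_) sum-as) (ℕP.m+[n∸m]≡n n<m))) ,
       trans (sumY-zipWith zs as) (trans (cong (λ t → + suc n - + t) sum-zs) (ring (+ n)))) ,
      subst (+ j <_) (sym (last-zipWith zs as)) (+<+ j<)
      where
      ring : ∀ n → (+ 1 + n) - n ≡ + 1
      ring = solve-∀

    IsCompositionPair-irrelevant : Irrelevant IsCompositionPair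
    IsCompositionPair-irrelevant (a , b , c) (a′ , b′ , c′) =
      cong₂ _,_ (uip a a′) (cong₂ _,_ (uip b b′) (ℕP.<-irrelevant c c′))

    pointed-vectors↔composition-pairs :
      Σ (Vec Step (suc n) × ℕ) (IsPointedVec n m) ↔ Σ ((Vec ℕ (suc n) × Vec ℕ (suc n)) × ℕ) IsCompositionPair
    pointed-vectors↔composition-pairs =
      restrict-↔ (λ (v , j) → (heightDrops v , extraWidths v) , j) (λ ((zs , as) , j) → Vec.zipWith mkStep zs as , j)
        (IsPointedVec-irrelevant n m) (λ {c} → IsCompositionPair-irrelevant {c})
        (λ {(v , j)} pointed → composition-of-path (heightDrops v) (extraWidths v) j
          (subst (λ v → IsPointedVec n m (v , j)) (sym (zipWith-inverse {n} {m} v (proj₁ (proj₁ pointed)))) pointed))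
        (λ {((zs , as) , j)} → path-of-composition zs as j)
        (λ {(v , j)} pointed → cong (_, j) (zipWith-inverse {n} {m} v (proj₁ (proj₁ pointed))))
        (λ {((zs , as) , j)} _ → cong (_, j) (cong₂ _,_ (heightDrops-zipWith zs as) (extraWidths-zipWith zs as)))

    PointedPath↔compositions : PointedPath n m ↔ (WeakComposition (suc n) n × PointedComposition n (m ∸ suc n))
    PointedPath↔compositions = begin
      PointedPath n m
        ↔⟨ PointedPath-reassoc n m ⟩
      Σ (Vec Step (suc n) × ℕ) (IsPointedVec n m)
        ↔⟨ pointed-vectors↔composition-pairs ⟩
      Σ ((Vec ℕ (suc n) × Vec ℕ (suc n)) × ℕ) IsCompositionPair
        ↔⟨ mk↔ₛ′ (λ (((zs , as) , j) , sum-zs , sum-as , j<) → (zs , sum-zs) , (as , j) , sum-as , j<)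
                 (λ ((zs , sum-zs) , (as , j) , sum-as , j<) → ((zs , as) , j) , sum-zs , sum-as , j<)
                 (λ _ → refl) (λ _ → refl) ⟩
      (WeakComposition (suc n) n × PointedComposition n (m ∸ suc n)) ∎
      where open EquationalReasoning {k = bijection}

open import Data.Nat using (_+_; _*_; _≤_; _<_)

PointedPath↔Fin : ∀ {n m} → 1 ≤ n → suc n ≤ m → PointedPath n m ↔ Fin (((2 * n) C n) * (m C (n + 1)))
PointedPath↔Fin {n} {m} 1≤n n<m = begin
  PointedPath n m
    ↔⟨ PointedPath↔compositions 1≤n n<m ⟩
  (WeakComposition (suc n) n × PointedComposition n (m ∸ suc n))
    ↔⟨ WeakComposition↔Fin n n ×-↔ PointedComposition↔Fin n (m ∸ suc n) ⟩
  (Fin ((n + n) C n) × Fin (suc (n + (m ∸ suc n)) C suc n))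
    ≡⟨ cong₂ (λ a b → Fin (a C n) × Fin b) (cong (n +_) (sym (ℕP.+-identityʳ n)))
             (cong₂ _C_ (ℕP.m+[n∸m]≡n n<m) (ℕP.+-comm 1 n)) ⟩
  (Fin ((2 * n) C n) × Fin (m C (n + 1)))
    ↔⟨ FinP.*↔× {(2 * n) C n} {m C (n + 1)} ⟨
  Fin (((2 * n) C n) * (m C (n + 1))) ∎
  where open EquationalReasoning {k = bijection}

corollary3p14 : (n m : ℕ) → 1 ≤ n → n + 1 ≤ m →
    Σ ℕ λ k → (m * k ≡ ((2 * n) C n) * (m C (n + 1))) ×
      ((r : ℕ) → r < m → (Fin k ↔ PointedWithPRML n m r))
corollary3p14 n m 1≤n n+1≤m =
  k , Fin-↔⇒≡ Fin[m*k]↔Fin[count] , λ r r<m → ↔-sym (↔-trans (PointedWithPRML↔PositivePath n m r r<m) positive↔Fin)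
  where
  n<m : suc n ≤ m
  n<m = subst (_≤ m) (ℕP.+-comm n 1) n+1≤m
  zero-fibre-finite : Σ ℕ λ k → PointedWithPRML n m 0 ↔ Fin k
  zero-fibre-finite = PointedWithPRML-finite n m 0 (PointedPath↔Fin 1≤n n<m)
  k : ℕ
  k = proj₁ zero-fibre-finite
  positive↔Fin : PositivePath n m ↔ Fin k
  positive↔Fin =
    ↔-trans (↔-sym (PointedWithPRML↔PositivePath n m 0 (ℕP.<-≤-trans (s≤s z≤n) n<m))) (proj₂ zero-fibre-finite)
  Fin[m*k]↔Fin[count] : Fin (m * k) ↔ Fin (((2 * n) C n) * (m C (n + 1)))
  Fin[m*k]↔Fin[count] = begin
    Fin (m * k)                                    ↔⟨ FinP.*↔× {m} {k} ⟩
    (Fin m × Fin k)                                ↔⟨ ↔-refl ×-↔ positive↔Fin ⟨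
    (Fin m × PositivePath n m)
      ↔⟨ Σ-↔ ↔-refl (λ {r} → PointedWithPRML↔PositivePath n m (toℕ r) (FinP.toℕ<n r)) ⟨
    Σ (Fin m) (λ r → PointedWithPRML n m (toℕ r))  ↔⟨ PointedPath↔PRML-fibres n m ⟨
    PointedPath n m                                ↔⟨ PointedPath↔Fin 1≤n n<m ⟩
    Fin (((2 * n) C n) * (m C (n + 1)))            ∎
    where open EquationalReasoning {k = bijection}
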